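{- Let $\mathcal{G}=\langle x,y: x^2=y^2=1\rangle$, whose elements are the reduced words alternating in $x$ and $y$. Order it as $W=(I,x,y,xy,yx,xyx,yxy,xyxy,yxyx,\dots)$ (by word length, with $x<y$), and let $w_m$ be the $m$-th element. Let $G_1=\{I\}$ and for $m\ge2$ let $G_m=G_{m-1}\cup\{w_m\}$ if $w_m$ does not form a 3-term geometric progression with elements of $G_{m-1}$, and $G_m=G_{m-1}$ otherwise; let $G=\bigcup_m G_m$. Then for every $n\ge 0$, $$\frac{|G\cap\{w\in W:\mathrm{length}(w)\le 2\cdot 3^n\}|}{|\{w\in W:\mathrm{length}(w)\le 2\cdot3^n\}|}\ =\ \frac{2^{n+1}}{1+4\cdot 3^n},$$ and in general $$\frac{|G\cap\{w\in W:\mathrm{length}(w)\le n\}|}{|\{w\in W:\mathrm{length}(w)\le n\}|}\ =\ \Theta\!\left((2/3)^{\log_3 n}\right).$$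
   Context: A 3-term geometric progression in $\mathcal{G}$ is a triple $a,\ ar,\ ar^2$ with $a,r\in\mathcal{G}$ and $r\neq I$. The element $w_m$ forms a 3-term geometric progression with elements of $G_{m-1}$ if there is such a triple, with $w_m$ among its terms and all its terms in $G_{m-1}\cup\{w_m\}$. The length of an element is the length of its reduced word. -}

module Defs where

open import Data.Nat using (ℕ; zero; suc; ⌊_/2⌋; _≤_)
open import Data.List using (List; []; _∷_; foldr; length)
open import Data.List.Relation.Unary.Unique.Propositional using (Unique)
open import Data.List.Membership.Propositional using (_∈_)
open import Data.Product using (Σ; ∃; _×_; _,_)
open import Data.Sum using (_⊎_)
open import Data.Empty using (⊥)
open import Data.Unit using (⊤)
open import Relation.Nullary using (¬_)
open import Relation.Binary.PropositionalEquality using (_≡_; _≢_)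
open import Function.Bundles using (_⇔_)

data Letter : Set where
  𝑥 𝑦 : Letter

Reduced : List Letter → Set
Reduced [] = ⊤
Reduced (_ ∷ []) = ⊤
Reduced (a ∷ b ∷ t) = a ≢ b × Reduced (b ∷ t)

-- Elements of 𝒢 are the reduced words; I is the empty word [].
I : List Letter
I = []

cons : Letter → List Letter → List Letter
cons 𝑥 (𝑥 ∷ t) = t
cons 𝑦 (𝑦 ∷ t) = t
cons l t = l ∷ t

_·_ : List Letter → List Letter → List Letter
u · v = foldr cons v u
infixl 7 _·_

other : Letter → Letter
other 𝑥 = 𝑦
other 𝑦 = 𝑥

alt : Letter → ℕ → List Letter
alt l zero = []
alt l (suc n) = l ∷ alt (other l) n

parity : ℕ → Letter
parity zero = 𝑥
parity (suc zero) = 𝑦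
parity (suc (suc n)) = parity n

-- w m : the m-th element (m ≥ 1) of W = (I, x, y, xy, yx, xyx, yxy, ...)
w : ℕ → List Letter
w m = alt (parity m) ⌊ m /2⌋

Subset : Set₁
Subset = List Letter → Set

_∪﹛_﹜ : Subset → List Letter → Subset
(S ∪﹛ v ﹜) u = S u ⊎ u ≡ v

-- v forms a 3-term geometric progression with elements of S:
-- there are a, r ∈ 𝒢, r ≠ I, with v among a, ar, ar² and all three in S ∪ {v}.
FormsGP : Subset → List Letter → Set
FormsGP S v =
  Σ (List Letter) λ a → Σ (List Letter) λ r →
    Reduced a × Reduced r × r ≢ I ×
    (v ≡ a ⊎ v ≡ a · r ⊎ v ≡ a · r · r) ×
    (S ∪﹛ v ﹜) a × (S ∪﹛ v ﹜) (a · r) × (S ∪﹛ v ﹜) (a · r · r)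

-- G_m  (G_0 = ∅ is only a technical base case; G_1 = {I})
Gm : ℕ → Subset
Gm zero u = ⊥
Gm (suc zero) u = u ≡ I
Gm (suc (suc m)) u =
  Gm (suc m) u ⊎ (u ≡ w (suc (suc m)) × ¬ FormsGP (Gm (suc m)) (w (suc (suc m))))

G : Subset
G u = ∃ λ m → Gm m u

Ball : ℕ → Subset
Ball N u = Reduced u × length u ≤ N

CountIs : Subset → ℕ → Set
CountIs P k = Σ (List (List Letter)) λ L →
  Unique L × (∀ u → (u ∈ L) ⇔ P u) × length L ≡ k

G∩Ball : ℕ → Subset
G∩Ball N u = G u × Ball N u

module Submission where

-- 𝒢 acts faithfully on ℤ by isometries (x : t ↦ -t, y : t ↦ -t - 1), so each
-- element is a translation t ↦ t + z (an even word) or a reflection (an odd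
-- word).  A reflection v forms the progression v, v·v = I, v·v·v = v, so it is
-- never taken; a progression a, ar, ar² of translations is a 3-term
-- arithmetic progression in ℤ.  In the order W the translation by 0, k, -k has
-- index 1, 4k, 4k + 1, so the greedy procedure runs through ℤ in the order
-- 0, 1, -1, 2, -2, …  Hence G consists of the translations by the greedy
-- 3-AP-free set P = {1 + 2c} ∪ {-2c}, c ranging over the numbers whose base-3
-- digits are 0 or 1.  There are 2^k such c below 3^k; this gives exactly 2·2^k
-- elements of G in the ball of radius 2·3^k (which has 1 + 4·3^k elements), and
-- by monotonicity of counts the Θ((2/3)^(log₃ n)) density at every radius n.

open import Defs

-- Halving natural numbers.  `double` is the doubling that computes letter by
-- letter on alternating words (alt l (double (suc i)) = l ∷ other l ∷ alt l (double i)).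
module Parity where

  open import Data.Nat using (ℕ; zero; suc; _+_)
  open import Data.Nat.Properties using (+-suc)
  open import Data.Product using (Σ; _,_)
  open import Data.Sum using (_⊎_; inj₁; inj₂)
  open import Relation.Binary.PropositionalEquality

  parity-split : ∀ n → Σ ℕ λ m → n ≡ m + m ⊎ n ≡ suc (m + m)
  parity-split zero = 0 , inj₁ refl
  parity-split (suc n) with parity-split n
  ... | m , inj₁ refl = m , inj₂ refl
  ... | m , inj₂ refl = suc m , inj₁ (cong suc (sym (+-suc m m)))

  double : ℕ → ℕ
  double zero = zero
  double (suc n) = suc (suc (double n))

  double≡+ : ∀ n → double n ≡ n + n
  double≡+ zero = refl
  double≡+ (suc n) = cong suc (trans (cong suc (double≡+ n)) (sym (+-suc n n)))

module Words where

  open import Data.Nat using (zero; suc)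
  open import Data.List using ([]; _∷_; length)
  open import Data.Product using (Σ; _,_)
  open import Data.Empty using (⊥-elim)
  open import Data.Unit using (tt)
  open import Relation.Binary.PropositionalEquality

  length-alt : ∀ l n → length (alt l n) ≡ n
  length-alt l zero = refl
  length-alt l (suc n) = cong suc (length-alt (other l) n)

  reduced-alt : ∀ l n → Reduced (alt l n)
  reduced-alt l zero = tt
  reduced-alt l (suc zero) = tt
  reduced-alt 𝑥 (suc (suc n)) = (λ ()) , reduced-alt 𝑦 (suc n)
  reduced-alt 𝑦 (suc (suc n)) = (λ ()) , reduced-alt 𝑥 (suc n)

  next-letter : ∀ {a b} → a ≢ b → b ≡ other a
  next-letter {𝑥} {𝑥} a≢b = ⊥-elim (a≢b refl)
  next-letter {𝑥} {𝑦} _ = refl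
  next-letter {𝑦} {𝑥} _ = refl
  next-letter {𝑦} {𝑦} a≢b = ⊥-elim (a≢b refl)

  reduced⇒alt : ∀ a t → Reduced (a ∷ t) → a ∷ t ≡ alt a (suc (length t))
  reduced⇒alt a [] _ = refl
  reduced⇒alt a (b ∷ t) (a≢b , red) =
    cong (a ∷_) (trans (reduced⇒alt b t red) (cong (λ l → alt l (suc (length t))) (next-letter a≢b)))

  reduced-alternates : ∀ u → Reduced u → Σ Letter λ l → u ≡ alt l (length u)
  reduced-alternates [] _ = 𝑥 , refl
  reduced-alternates (a ∷ t) red = a , reduced⇒alt a t red

  reduced-tail : ∀ {l t} → Reduced (l ∷ t) → Reduced t
  reduced-tail {t = []} _ = tt
  reduced-tail {t = _ ∷ _} (_ , red) = red

  reduced-cons : ∀ l t → Reduced t → Reduced (cons l t)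
  reduced-cons 𝑥 [] _ = tt
  reduced-cons 𝑥 (𝑥 ∷ t) red = reduced-tail red
  reduced-cons 𝑥 (𝑦 ∷ t) red = (λ ()) , red
  reduced-cons 𝑦 [] _ = tt
  reduced-cons 𝑦 (𝑥 ∷ t) red = (λ ()) , red
  reduced-cons 𝑦 (𝑦 ∷ t) red = reduced-tail red

  reduced-· : ∀ u v → Reduced v → Reduced (u · v)
  reduced-· [] v red = red
  reduced-· (l ∷ t) v red = reduced-cons l (t · v) (reduced-· t v red)

-- The faithful model of 𝒢: the isometries t ↦ ±t + z of ℤ, where x acts as
-- t ↦ -t and y as t ↦ -t - 1, so that xy is the translation t ↦ t + 1.
-- A reduced word is determined by the isometry it denotes.
module Isometry where

  open Parity
  open Words
  open import Data.Nat using (zero; suc)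
  import Data.Nat.Properties as ℕP
  open import Data.Integer using (ℤ; +_; -[1+_]; _+_; -_)
  import Data.Integer.Properties as ℤP
  open import Data.Integer.Tactic.RingSolver using (solve-∀)
  open import Data.Bool using (Bool; true; false; _xor_)
  open import Data.Bool.Properties using (xor-assoc)
  open import Data.List using (List; []; _∷_)
  open import Data.Product using (_×_; _,_)
  open import Data.Sum using (inj₁; inj₂)
  open import Relation.Binary.PropositionalEquality
  open ≡-Reasoning

  -- (true , z) is the reflection t ↦ -t + z, (false , z) the translation t ↦ t + z
  Isom : Set
  Isom = Bool × ℤ

  signed : Bool → ℤ → ℤ
  signed false z = z
  signed true z = - z

  -- composition: (f ⊙ g) t = f (g t)
  _⊙_ : Isom → Isom → Isom
  (s , z) ⊙ (s′ , z′) = (s xor s′ , signed s z′ + z)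
  infixr 7 _⊙_

  idᴵ : Isom
  idᴵ = (false , + 0)

  signed-xor : ∀ s s′ z → signed (s xor s′) z ≡ signed s (signed s′ z)
  signed-xor true true z = sym (ℤP.neg-involutive z)
  signed-xor true false z = refl
  signed-xor false s′ z = refl

  signed-+ : ∀ s a b → signed s (a + b) ≡ signed s a + signed s b
  signed-+ false a b = refl
  signed-+ true a b = ℤP.neg-distrib-+ a b

  ⊙-assoc : ∀ f g h → (f ⊙ g) ⊙ h ≡ f ⊙ (g ⊙ h)
  ⊙-assoc (s₁ , z₁) (s₂ , z₂) (s₃ , z₃) = cong₂ _,_ (xor-assoc s₁ s₂ s₃) (begin
    signed (s₁ xor s₂) z₃ + (signed s₁ z₂ + z₁)    ≡⟨ cong (_+ _) (signed-xor s₁ s₂ z₃) ⟩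
    signed s₁ (signed s₂ z₃) + (signed s₁ z₂ + z₁) ≡⟨ sym (ℤP.+-assoc (signed s₁ (signed s₂ z₃)) (signed s₁ z₂) z₁) ⟩
    signed s₁ (signed s₂ z₃) + signed s₁ z₂ + z₁   ≡⟨ cong (_+ z₁) (sym (signed-+ s₁ (signed s₂ z₃) z₂)) ⟩
    signed s₁ (signed s₂ z₃ + z₂) + z₁             ∎)

  ⊙-identityˡ : ∀ f → idᴵ ⊙ f ≡ f
  ⊙-identityˡ (s , z) = cong (s ,_) (ℤP.+-identityʳ z)

  reflection-involutive : ∀ c f → (true , c) ⊙ (true , c) ⊙ f ≡ f
  reflection-involutive c f = begin
    (true , c) ⊙ (true , c) ⊙ f   ≡⟨ sym (⊙-assoc (true , c) (true , c) f) ⟩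
    (false , - c + c) ⊙ f         ≡⟨ cong (λ z → (false , z) ⊙ f) (ℤP.+-inverseˡ c) ⟩
    idᴵ ⊙ f                       ≡⟨ ⊙-identityˡ f ⟩
    f                             ∎

  ⟦_⟧ₗ : Letter → Isom
  ⟦ 𝑥 ⟧ₗ = (true , + 0)
  ⟦ 𝑦 ⟧ₗ = (true , -[1+ 0 ])

  ⟦_⟧ : List Letter → Isom
  ⟦ [] ⟧ = idᴵ
  ⟦ l ∷ t ⟧ = ⟦ l ⟧ₗ ⊙ ⟦ t ⟧

  ⟦cons⟧ : ∀ l t → ⟦ cons l t ⟧ ≡ ⟦ l ⟧ₗ ⊙ ⟦ t ⟧
  ⟦cons⟧ 𝑥 [] = refl
  ⟦cons⟧ 𝑥 (𝑥 ∷ t) = sym (reflection-involutive (+ 0) ⟦ t ⟧)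
  ⟦cons⟧ 𝑥 (𝑦 ∷ t) = refl
  ⟦cons⟧ 𝑦 [] = refl
  ⟦cons⟧ 𝑦 (𝑥 ∷ t) = refl
  ⟦cons⟧ 𝑦 (𝑦 ∷ t) = sym (reflection-involutive -[1+ 0 ] ⟦ t ⟧)

  ⟦·⟧ : ∀ u v → ⟦ u · v ⟧ ≡ ⟦ u ⟧ ⊙ ⟦ v ⟧
  ⟦·⟧ [] v = sym (⊙-identityˡ ⟦ v ⟧)
  ⟦·⟧ (l ∷ t) v = begin
    ⟦ cons l (t · v) ⟧      ≡⟨ ⟦cons⟧ l (t · v) ⟩
    ⟦ l ⟧ₗ ⊙ ⟦ t · v ⟧      ≡⟨ cong (⟦ l ⟧ₗ ⊙_) (⟦·⟧ t v) ⟩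
    ⟦ l ⟧ₗ ⊙ ⟦ t ⟧ ⊙ ⟦ v ⟧  ≡⟨ sym (⊙-assoc ⟦ l ⟧ₗ ⟦ t ⟧ ⟦ v ⟧) ⟩
    (⟦ l ⟧ₗ ⊙ ⟦ t ⟧) ⊙ ⟦ v ⟧ ∎

  ⟦alt-x-even⟧ : ∀ i → ⟦ alt 𝑥 (double i) ⟧ ≡ (false , + i)
  ⟦alt-x-even⟧ zero = refl
  ⟦alt-x-even⟧ (suc i) rewrite ⟦alt-x-even⟧ i = cong (false ,_) (shift (+ i))
    where
    shift : ∀ a → - (- a + -[1+ 0 ]) + + 0 ≡ + 1 + a
    shift = solve-∀

  ⟦alt-y-even⟧ : ∀ i → ⟦ alt 𝑦 (double i) ⟧ ≡ (false , - + i)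
  ⟦alt-y-even⟧ zero = refl
  ⟦alt-y-even⟧ (suc i) rewrite ⟦alt-y-even⟧ i = cong (false ,_) (shift (+ i))
    where
    shift : ∀ a → - (- - a + + 0) + -[1+ 0 ] ≡ - (+ 1 + a)
    shift = solve-∀

  ⟦alt-x-odd⟧ : ∀ i → ⟦ alt 𝑥 (suc (double i)) ⟧ ≡ (true , + i)
  ⟦alt-x-odd⟧ i rewrite ⟦alt-y-even⟧ i =
    cong (true ,_) (trans (ℤP.+-identityʳ (- - + i)) (ℤP.neg-involutive (+ i)))

  ⟦alt-y-odd⟧ : ∀ i → ⟦ alt 𝑦 (suc (double i)) ⟧ ≡ (true , -[1+ i ])
  ⟦alt-y-odd⟧ i rewrite ⟦alt-x-even⟧ i = cong (true ,_) (minus-suc i)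
    where
    minus-suc : ∀ i → - + i + -[1+ 0 ] ≡ -[1+ i ]
    minus-suc zero = refl
    minus-suc (suc j) = cong (λ k → -[1+ suc k ]) (ℕP.+-identityʳ j)

  word : Isom → List Letter
  word (false , + i) = alt 𝑥 (double i)
  word (false , -[1+ i ]) = alt 𝑦 (double (suc i))
  word (true , + i) = alt 𝑥 (suc (double i))
  word (true , -[1+ i ]) = alt 𝑦 (suc (double i))

  reduced-word : ∀ f → Reduced (word f)
  reduced-word (false , + i) = reduced-alt 𝑥 (double i)
  reduced-word (false , -[1+ i ]) = reduced-alt 𝑦 (double (suc i))
  reduced-word (true , + i) = reduced-alt 𝑥 (suc (double i))
  reduced-word (true , -[1+ i ]) = reduced-alt 𝑦 (suc (double i))

  ⟦word⟧ : ∀ f → ⟦ word f ⟧ ≡ f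
  ⟦word⟧ (false , + i) = ⟦alt-x-even⟧ i
  ⟦word⟧ (false , -[1+ i ]) = ⟦alt-y-even⟧ (suc i)
  ⟦word⟧ (true , + i) = ⟦alt-x-odd⟧ i
  ⟦word⟧ (true , -[1+ i ]) = ⟦alt-y-odd⟧ i

  word-⟦alt⟧ : ∀ l n → word ⟦ alt l n ⟧ ≡ alt l n
  word-⟦alt⟧ l n with parity-split n
  ... | i , inj₁ refl rewrite sym (double≡+ i) = even l i
    where
    even : ∀ l i → word ⟦ alt l (double i) ⟧ ≡ alt l (double i)
    even 𝑥 i rewrite ⟦alt-x-even⟧ i = refl
    even 𝑦 zero = refl
    even 𝑦 (suc i) rewrite ⟦alt-y-even⟧ (suc i) = refl
  ... | i , inj₂ refl rewrite sym (double≡+ i) = odd l i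
    where
    odd : ∀ l i → word ⟦ alt l (suc (double i)) ⟧ ≡ alt l (suc (double i))
    odd 𝑥 i rewrite ⟦alt-x-odd⟧ i = refl
    odd 𝑦 i rewrite ⟦alt-y-odd⟧ i = refl

  reduced-unique : ∀ {u f} → Reduced u → ⟦ u ⟧ ≡ f → u ≡ word f
  reduced-unique {u} red refl with reduced-alternates u red
  ... | l , eq = trans eq (trans (sym (word-⟦alt⟧ l _)) (cong (λ v → word ⟦ v ⟧) (sym eq)))

-- Numbers all of whose base-3 digits are 0 or 1.  They form the greedy
-- 3-AP-free subset of ℕ: they contain no 3-AP, and every other number is the
-- last term of a 3-AP whose first two terms are smaller such numbers.
module CantorNumbers where

  open import Data.Nat using (ℕ; zero; suc; _+_; _*_; _^_; _≤_; _<_; z≤n; s≤s; NonZero)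
  open import Data.Nat.Properties
  open import Data.Nat.DivMod using (_%_; _/_; m%n<n; m≡m%n+[m/n]*n; m<n⇒m%n≡m; [m+kn]%n≡m%n; m/n<m)
  open import Data.Nat.Induction using (<-rec)
  open import Data.Nat.Tactic.RingSolver using (solve-∀)
  open import Data.Product using (Σ; _×_; _,_; proj₁; proj₂)
  open import Data.Sum using (_⊎_; inj₁; inj₂)
  open import Data.List using (List; []; _∷_; length; map; _++_)
  open import Data.List.Properties using (length-map; length-++)
  open import Data.List.Membership.Propositional using (_∈_)
  open import Data.List.Membership.Propositional.Properties using (∈-map⁺; ∈-map⁻; ∈-++⁺ˡ; ∈-++⁺ʳ; ∈-++⁻)
  open import Data.List.Relation.Unary.Any using (here)
  open import Data.List.Relation.Unary.All using ([])
  open import Data.List.Relation.Unary.AllPairs using ([]; _∷_)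
  open import Data.List.Relation.Unary.Unique.Propositional using (Unique)
  import Data.List.Relation.Unary.Unique.Propositional.Properties as Unique
  open import Relation.Nullary using (¬_)
  open import Relation.Binary.PropositionalEquality
  open ≡-Reasoning

  data Digit : ℕ → Set where
    d0 : Digit 0
    d1 : Digit 1

  data Cantor : ℕ → Set where
    none : Cantor 0
    snoc : ∀ {d n} → Digit d → Cantor n → Cantor (d + 3 * n)

  digit-unique : ∀ b .{{_ : NonZero b}} {d d′ q q′} → d < b → d′ < b →
                 d + b * q ≡ d′ + b * q′ → d ≡ d′ × q ≡ q′
  digit-unique b {d} {d′} {q} {q′} d<b d′<b eq = same-digit , same-quotient
    where
    mod-b : ∀ {r} k → r < b → (r + b * k) % b ≡ r
    mod-b {r} k r<b = trans (cong (λ t → (r + t) % b) (*-comm b k))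
                            (trans ([m+kn]%n≡m%n r k b) (m<n⇒m%n≡m r<b))
    same-digit : d ≡ d′
    same-digit = trans (sym (mod-b q d<b)) (trans (cong (_% b) eq) (mod-b q′ d′<b))
    same-quotient : q ≡ q′
    same-quotient = *-cancelˡ-≡ q q′ b (+-cancelˡ-≡ d _ _ (trans eq (cong (_+ b * q′) (sym same-digit))))

  base-expansion : ∀ n b .{{_ : NonZero b}} → n ≡ n % b + b * (n / b)
  base-expansion n b = trans (m≡m%n+[m/n]*n n b) (cong (n % b +_) (*-comm (n / b) b))

  ternary-induction : (P : ℕ → Set) → P 0 →
                      (∀ {q} → P q → P (3 * q)) → (∀ {q} → P q → P (1 + 3 * q)) →
                      (∀ {q} → P q → P (2 + 3 * q)) → ∀ n → P n
  ternary-induction P base step₀ step₁ step₂ = <-rec P go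
    where
    with-digit : ∀ r q → r < 3 → P q → P (r + 3 * q)
    with-digit 0 q _ = step₀
    with-digit 1 q _ = step₁
    with-digit 2 q _ = step₂
    with-digit (suc (suc (suc _))) q (s≤s (s≤s (s≤s ())))
    go : ∀ n → (∀ {m} → m < n → P m) → P n
    go zero _ = base
    go n@(suc _) rec = subst P (sym (base-expansion n 3))
      (with-digit (n % 3) (n / 3) (m%n<n n 3) (rec (m/n<m n 3 (s≤s (s≤s z≤n)))))

  last-digit : ∀ {n} → Cantor n → Σ ℕ λ d → Σ ℕ λ n′ → Digit d × Cantor n′ × n ≡ d + 3 * n′
  last-digit none = 0 , 0 , d0 , none , refl
  last-digit (snoc {d} {n′} dd c) = d , n′ , dd , c , refl

  regroup : ∀ x y z w → (x + 3 * y) + (z + 3 * w) ≡ (x + z) + 3 * (y + w)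
  regroup = solve-∀

  digit-sum<3 : ∀ {d e} → Digit d → Digit e → d + e < 3
  digit-sum<3 d0 d0 = s≤s z≤n
  digit-sum<3 d0 d1 = s≤s (s≤s z≤n)
  digit-sum<3 d1 d0 = s≤s (s≤s z≤n)
  digit-sum<3 d1 d1 = s≤s (s≤s (s≤s z≤n))

  digit-AP-free : ∀ {a b c} → Digit a → Digit b → Digit c → a + c ≡ b + b → a ≡ c
  digit-AP-free d0 _ d0 _ = refl
  digit-AP-free d1 _ d1 _ = refl
  digit-AP-free d0 d0 d1 ()
  digit-AP-free d0 d1 d1 ()
  digit-AP-free d1 d0 d0 ()
  digit-AP-free d1 d1 d0 ()

  -- no digit carries in a + c = 2b, so the AP condition holds digitwise
  cantor-AP-free : ∀ {a b c} → Cantor a → Cantor b → Cantor c → a + c ≡ b + b → a ≡ c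
  cantor-AP-free {a} ca none cc eq = trans (m+n≡0⇒m≡0 a eq) (sym (m+n≡0⇒n≡0 a eq))
  cantor-AP-free ca (snoc {db} {b′} ddb cb′) cc eq with last-digit ca | last-digit cc
  ... | da , a′ , dda , ca′ , refl | dc , c′ , ddc , cc′ , refl =
    cong₂ (λ d q → d + 3 * q) (digit-AP-free dda ddb ddc (proj₁ digits))
                              (cantor-AP-free ca′ cb′ cc′ (proj₂ digits))
    where
    digits : da + dc ≡ db + db × a′ + c′ ≡ b′ + b′
    digits = digit-unique 3 (digit-sum<3 dda ddc) (digit-sum<3 ddb ddb) (begin
      (da + dc) + 3 * (a′ + c′)          ≡⟨ sym (regroup da a′ dc c′) ⟩
      (da + 3 * a′) + (dc + 3 * c′)      ≡⟨ eq ⟩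
      (db + 3 * b′) + (db + 3 * b′)      ≡⟨ regroup db b′ db b′ ⟩
      (db + db) + 3 * (b′ + b′)          ∎)

  CompletesAP : ℕ → Set
  CompletesAP n = Σ ℕ λ a → Σ ℕ λ b → Cantor a × Cantor b × a < b × n + a ≡ b + b

  AP-append : ∀ d e f n a b → d + e ≡ f + f → n + a ≡ b + b →
              (d + 3 * n) + (e + 3 * a) ≡ (f + 3 * b) + (f + 3 * b)
  AP-append d e f n a b digits ap = begin
    (d + 3 * n) + (e + 3 * a)      ≡⟨ regroup d n e a ⟩
    (d + e) + 3 * (n + a)          ≡⟨ cong₂ (λ s t → s + 3 * t) digits ap ⟩
    (f + f) + 3 * (b + b)          ≡⟨ sym (regroup f b f b) ⟩
    (f + 3 * b) + (f + 3 * b)      ∎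

  completes-append : ∀ {d e f n} → Digit e → Digit f → e ≤ f → d + e ≡ f + f →
                     CompletesAP n → CompletesAP (d + 3 * n)
  completes-append {d} {e} {f} {n} de df e≤f digits (a , b , ca , cb , a<b , ap) =
    e + 3 * a , f + 3 * b , snoc de ca , snoc df cb , +-mono-≤-< e≤f (*-monoʳ-< 3 a<b) ,
    AP-append d e f n a b digits ap

  cantor-or-completes : ∀ n → Cantor n ⊎ CompletesAP n
  cantor-or-completes = ternary-induction (λ n → Cantor n ⊎ CompletesAP n) (inj₁ none)
    extend₀ extend₁ extend₂
    where
    extend₀ : ∀ {q} → Cantor q ⊎ CompletesAP q → Cantor (3 * q) ⊎ CompletesAP (3 * q)
    extend₀ (inj₁ cq) = inj₁ (snoc d0 cq)
    extend₀ (inj₂ w) = inj₂ (completes-append {0} d0 d0 z≤n refl w)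
    extend₁ : ∀ {q} → Cantor q ⊎ CompletesAP q → Cantor (1 + 3 * q) ⊎ CompletesAP (1 + 3 * q)
    extend₁ (inj₁ cq) = inj₁ (snoc d1 cq)
    extend₁ (inj₂ w) = inj₂ (completes-append {1} d1 d1 ≤-refl refl w)
    -- 2 + 3q completes the 3-AP 3q, 1 + 3q, 2 + 3q
    extend₂ : ∀ {q} → Cantor q ⊎ CompletesAP q → Cantor (2 + 3 * q) ⊎ CompletesAP (2 + 3 * q)
    extend₂ {q} (inj₁ cq) =
      inj₂ (3 * q , 1 + 3 * q , snoc d0 cq , snoc d1 cq , n<1+n (3 * q) , AP-append 2 0 1 q q q refl refl)
    extend₂ (inj₂ w) = inj₂ (completes-append {2} d0 d1 z≤n refl w)

  -- every number is 2b + a with a, b ∈ Cantor (take the digits 1 of n in a, the digits 2 in b)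
  TwicePlus : ℕ → Set
  TwicePlus m = Σ ℕ λ a → Σ ℕ λ b → Cantor a × Cantor b × m ≡ (b + b) + a

  twice-plus : ∀ m → TwicePlus m
  twice-plus = ternary-induction TwicePlus (0 , 0 , none , none , refl)
    (extend {0} d0 d0 refl) (extend {1} d1 d0 refl) (extend {2} d0 d1 refl)
    where
    extend : ∀ {d e f} → Digit e → Digit f → d ≡ (f + f) + e → ∀ {q} → TwicePlus q → TwicePlus (d + 3 * q)
    extend {e = e} {f} de df refl (a , b , ca , cb , refl) =
      e + 3 * a , f + 3 * b , snoc de ca , snoc df cb , append e f a b
      where
      append : ∀ e f a b → ((f + f) + e) + 3 * ((b + b) + a) ≡ ((f + 3 * b) + (f + 3 * b)) + (e + 3 * a)
      append = solve-∀

  cantor-bound : ∀ k {c} → Cantor c → c < 3 ^ k → suc (c + c) ≤ 3 ^ k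
  cantor-bound zero {zero} _ _ = ≤-refl
  cantor-bound zero {suc _} _ (s≤s ())
  cantor-bound (suc k) none _ = m^n>0 3 (suc k)
  cantor-bound (suc k) (snoc {d} {n} dd cn) c< =
    ≤-trans (doubled dd) (*-monoʳ-≤ 3 (cantor-bound k cn n<))
    where
    n< : n < 3 ^ k
    n< = *-cancelˡ-< 3 n (3 ^ k) (≤-<-trans (m≤n+m (3 * n) d) c<)
    doubled : ∀ {d} → Digit d → suc ((d + 3 * n) + (d + 3 * n)) ≤ 3 * suc (n + n)
    doubled d0 = ≤-trans (m≤n+m _ 2) (≤-reflexive (sym (spread₀ n)))
      where
      spread₀ : ∀ n → 3 * suc (n + n) ≡ 2 + suc (3 * n + 3 * n)
      spread₀ = solve-∀
    doubled d1 = ≤-reflexive (spread₁ n)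
      where
      spread₁ : ∀ n → suc ((1 + 3 * n) + (1 + 3 * n)) ≡ 3 * suc (n + n)
      spread₁ = solve-∀

  append-< : ∀ b {d c M} → d < b → c < M → d + b * c < b * M
  append-< b {d} {c} d<b c<M = ≤-trans (+-mono-<-≤ d<b ≤-refl)
    (≤-trans (≤-reflexive (sym (*-suc b c))) (*-monoʳ-≤ b c<M))

  cantor-below : ℕ → List ℕ
  cantor-below zero = 0 ∷ []
  cantor-below (suc k) = map (3 *_) (cantor-below k) ++ map (λ c → 1 + 3 * c) (cantor-below k)

  ∈-cantor-below⁻ : ∀ k {c} → c ∈ cantor-below k → Cantor c × c < 3 ^ k
  ∈-cantor-below⁻ zero (here refl) = none , s≤s z≤n
  ∈-cantor-below⁻ (suc k) c∈ with ∈-++⁻ (map (3 *_) (cantor-below k)) c∈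
  ... | inj₁ c∈₀ with ∈-map⁻ (3 *_) c∈₀
  ...   | c , c∈′ , refl with ∈-cantor-below⁻ k c∈′
  ...     | cc , c< = snoc d0 cc , append-< 3 {0} (s≤s z≤n) c<
  ∈-cantor-below⁻ (suc k) c∈ | inj₂ c∈₁ with ∈-map⁻ (λ c → 1 + 3 * c) c∈₁
  ...   | c , c∈′ , refl with ∈-cantor-below⁻ k c∈′
  ...     | cc , c< = snoc d1 cc , append-< 3 {1} (s≤s (s≤s z≤n)) c<

  ∈-cantor-below⁺ : ∀ k {c} → Cantor c → c < 3 ^ k → c ∈ cantor-below k
  ∈-cantor-below⁺ zero {zero} _ _ = here refl
  ∈-cantor-below⁺ zero {suc _} _ (s≤s ())
  ∈-cantor-below⁺ (suc k) cc c< with last-digit cc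
  ... | 0 , c′ , d0 , cc′ , refl =
    ∈-++⁺ˡ (∈-map⁺ (3 *_) (∈-cantor-below⁺ k cc′ (*-cancelˡ-< 3 c′ (3 ^ k) c<)))
  ... | 1 , c′ , d1 , cc′ , refl =
    ∈-++⁺ʳ (map (3 *_) (cantor-below k)) (∈-map⁺ (λ c → 1 + 3 * c)
      (∈-cantor-below⁺ k cc′ (*-cancelˡ-< 3 c′ (3 ^ k) (≤-<-trans (m≤n+m (3 * c′) 1) c<))))

  unique-cantor-below : ∀ k → Unique (cantor-below k)
  unique-cantor-below zero = [] ∷ []
  unique-cantor-below (suc k) =
    Unique.++⁺ (Unique.map⁺ (*-cancelˡ-≡ _ _ 3) (unique-cantor-below k))
               (Unique.map⁺ (λ eq → *-cancelˡ-≡ _ _ 3 (suc-injective eq)) (unique-cantor-below k))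
               disjoint
    where
    disjoint : ∀ {v} → ¬ (v ∈ map (3 *_) (cantor-below k) × v ∈ map (λ c → 1 + 3 * c) (cantor-below k))
    disjoint (v∈₀ , v∈₁) with ∈-map⁻ (3 *_) v∈₀ | ∈-map⁻ (λ c → 1 + 3 * c) v∈₁
    ... | a , _ , refl | b , _ , eq with digit-unique 3 {0} {1} {a} {b} (s≤s z≤n) (s≤s (s≤s z≤n)) eq
    ...   | () , _

  length-cantor-below : ∀ k → length (cantor-below k) ≡ 2 ^ k
  length-cantor-below zero = refl
  length-cantor-below (suc k) = begin
    length (map (3 *_) (cantor-below k) ++ map (λ c → 1 + 3 * c) (cantor-below k))
      ≡⟨ length-++ (map (3 *_) (cantor-below k)) ⟩
    length (map (3 *_) (cantor-below k)) + length (map (λ c → 1 + 3 * c) (cantor-below k))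
      ≡⟨ cong₂ _+_ (length-map (3 *_) (cantor-below k)) (length-map (λ c → 1 + 3 * c) (cantor-below k)) ⟩
    length (cantor-below k) + length (cantor-below k)
      ≡⟨ cong (λ n → n + n) (length-cantor-below k) ⟩
    2 ^ k + 2 ^ k
      ≡⟨ cong (2 ^ k +_) (sym (+-identityʳ (2 ^ k))) ⟩
    2 ^ suc k ∎

module GreedyInℤ where

  open Parity using (parity-split)
  open CantorNumbers
  open import Data.Nat as ℕ using (ℕ; zero; suc; z≤n; s≤s)
  import Data.Nat.Properties as ℕP
  import Data.Nat.Tactic.RingSolver as ℕSolver
  open import Data.Integer using (ℤ; +_; -[1+_]; _+_; -_; _-_; ∣_∣)
  import Data.Integer.Properties as ℤP
  open import Data.Integer.Tactic.RingSolver using (solve-∀)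
  open import Data.Product using (Σ; _×_; _,_)
  open import Data.Sum using (_⊎_; inj₁; inj₂)
  open import Data.Empty using (⊥-elim)
  open import Relation.Binary.PropositionalEquality
  open ≡-Reasoning

  p⁺ p⁻ : ℕ → ℤ
  p⁺ c = + 1 + (+ c + + c)
  p⁻ c = - (+ c + + c)

  InP : ℤ → Set
  InP z = Σ ℕ λ c → Cantor c × (z ≡ p⁺ c ⊎ z ≡ p⁻ c)

  half : ∀ a b → a ℕ.+ a ≡ b ℕ.+ b → a ≡ b
  half a b eq = trans (ℕP.n≡⌊n+n/2⌋ a) (trans (cong ℕ.⌊_/2⌋ eq) (sym (ℕP.n≡⌊n+n/2⌋ b)))

  twice-sum : ∀ a c → (a ℕ.+ a) ℕ.+ (c ℕ.+ c) ≡ (a ℕ.+ c) ℕ.+ (a ℕ.+ c)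
  twice-sum = ℕSolver.solve-∀

  double-AP : ∀ a b c → a ℕ.+ c ≡ b ℕ.+ b → (a ℕ.+ a) ℕ.+ (c ℕ.+ c) ≡ (b ℕ.+ b) ℕ.+ (b ℕ.+ b)
  double-AP a b c eq = trans (twice-sum a c) (trans (cong (λ t → t ℕ.+ t) eq) (sym (twice-sum b b)))

  halve-AP : ∀ a b c → (a ℕ.+ a) ℕ.+ (c ℕ.+ c) ≡ (b ℕ.+ b) ℕ.+ (b ℕ.+ b) → a ℕ.+ c ≡ b ℕ.+ b
  halve-AP a b c eq = half (a ℕ.+ c) (b ℕ.+ b) (trans (sym (twice-sum a c)) (trans eq (twice-sum b b)))

  -- sums of two elements of the same half of P, as integers of known sign
  p⁺-sum : ∀ a c → p⁺ a + p⁺ c ≡ + suc (suc ((a ℕ.+ a) ℕ.+ (c ℕ.+ c)))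
  p⁺-sum a c = cong (λ t → + suc t) (ℕP.+-suc (a ℕ.+ a) (c ℕ.+ c))

  p⁻-sum : ∀ a c → p⁻ a + p⁻ c ≡ - + ((a ℕ.+ a) ℕ.+ (c ℕ.+ c))
  p⁻-sum a c = sym (ℤP.neg-distrib-+ (+ (a ℕ.+ a)) (+ (c ℕ.+ c)))

  p⁺-AP : ∀ a b c → a ℕ.+ c ≡ b ℕ.+ b → p⁺ a + p⁺ c ≡ p⁺ b + p⁺ b
  p⁺-AP a b c eq = trans (p⁺-sum a c) (trans (cong (λ t → + suc (suc t)) (double-AP a b c eq)) (sym (p⁺-sum b b)))

  p⁺-AP⁻¹ : ∀ a b c → p⁺ a + p⁺ c ≡ p⁺ b + p⁺ b → a ℕ.+ c ≡ b ℕ.+ b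
  p⁺-AP⁻¹ a b c eq =
    halve-AP a b c (ℕP.suc-injective (ℕP.suc-injective (ℤP.+-injective (trans (sym (p⁺-sum a c)) (trans eq (p⁺-sum b b))))))

  p⁻-AP : ∀ a b c → a ℕ.+ c ≡ b ℕ.+ b → p⁻ a + p⁻ c ≡ p⁻ b + p⁻ b
  p⁻-AP a b c eq = trans (p⁻-sum a c) (trans (cong (λ t → - + t) (double-AP a b c eq)) (sym (p⁻-sum b b)))

  p⁻-AP⁻¹ : ∀ a b c → p⁻ a + p⁻ c ≡ p⁻ b + p⁻ b → a ℕ.+ c ≡ b ℕ.+ b
  p⁻-AP⁻¹ a b c eq =
    halve-AP a b c (ℤP.+-injective (ℤP.neg-injective (trans (sym (p⁻-sum a c)) (trans eq (p⁻-sum b b)))))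

  positive≢nonpositive : ∀ n m → + suc n ≢ - + m
  positive≢nonpositive n zero ()
  positive≢nonpositive n (suc m) ()

  p⁺≢p⁻ : ∀ a b → p⁺ a ≢ p⁻ b
  p⁺≢p⁻ a b = positive≢nonpositive (a ℕ.+ a) (b ℕ.+ b)

  p⁺-injective : ∀ a b → p⁺ a ≡ p⁺ b → a ≡ b
  p⁺-injective a b eq = half a b (ℕP.suc-injective (ℤP.+-injective eq))

  p⁻-injective : ∀ a b → p⁻ a ≡ p⁻ b → a ≡ b
  p⁻-injective a b eq = half a b (ℤP.+-injective (ℤP.neg-injective eq))

  twice≢1 : ∀ w → w + w ≢ + 1
  twice≢1 (+ zero) ()
  twice≢1 (+ suc n) eq with trans (sym (ℕP.+-suc n n)) (ℕP.suc-injective (ℤP.+-injective eq))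
  ... | ()
  twice≢1 -[1+ n ] ()

  odd≢even : ∀ x y → + 1 + (x + x) ≢ y + y
  odd≢even x y eq = twice≢1 (y - x) (begin
    (y - x) + (y - x)         ≡⟨ twice-difference x y ⟩
    (y + y) - (x + x)         ≡⟨ cong (_- (x + x)) (sym eq) ⟩
    (+ 1 + (x + x)) - (x + x) ≡⟨ cancel x ⟩
    + 1                       ∎)
    where
    twice-difference : ∀ x y → (y - x) + (y - x) ≡ (y + y) - (x + x)
    twice-difference = solve-∀
    cancel : ∀ x → (+ 1 + (x + x)) - (x + x) ≡ + 1
    cancel = solve-∀

  p⁺+p⁻-odd : ∀ a c b → p⁺ a + p⁻ c ≢ b + b
  p⁺+p⁻-odd a c b eq = odd≢even (+ a - + c) b (trans (sym (as-odd (+ a) (+ c))) eq)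
    where
    as-odd : ∀ x y → (+ 1 + (x + x)) + - (y + y) ≡ + 1 + ((x - y) + (x - y))
    as-odd = solve-∀

  -- P contains no 3-AP: parity forces a, c into the same half of P, sign then
  -- forces b into it too, and the half is an affine image of Cantor
  P-AP-free : ∀ {a b c} → InP a → InP b → InP c → a + c ≡ b + b → a ≡ c
  P-AP-free (a , ca , inj₁ refl) (b , cb , inj₁ refl) (c , cc , inj₁ refl) eq =
    cong p⁺ (cantor-AP-free ca cb cc (p⁺-AP⁻¹ a b c eq))
  P-AP-free (a , ca , inj₂ refl) (b , cb , inj₂ refl) (c , cc , inj₂ refl) eq =
    cong p⁻ (cantor-AP-free ca cb cc (p⁻-AP⁻¹ a b c eq))
  P-AP-free (a , _ , inj₁ refl) (b , _ , inj₂ refl) (c , _ , inj₁ refl) eq =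
    ⊥-elim (positive≢nonpositive _ _ (trans (sym (p⁺-sum a c)) (trans eq (p⁻-sum b b))))
  P-AP-free (a , _ , inj₂ refl) (b , _ , inj₁ refl) (c , _ , inj₂ refl) eq =
    ⊥-elim (positive≢nonpositive _ _ (trans (sym (p⁺-sum b b)) (trans (sym eq) (p⁻-sum a c))))
  P-AP-free {b = b} (a , _ , inj₁ refl) _ (c , _ , inj₂ refl) eq = ⊥-elim (p⁺+p⁻-odd a c b eq)
  P-AP-free {b = b} (a , _ , inj₂ refl) _ (c , _ , inj₁ refl) eq =
    ⊥-elim (p⁺+p⁻-odd c a b (trans (ℤP.+-comm (p⁺ c) (p⁻ a)) eq))

  -- the index of the translation by z in W:  0 ↦ 1,  k ↦ 4k,  -k ↦ 4k + 1
  position : ℤ → ℕ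
  position (+ zero) = 1
  position (+ suc i) = 4 ℕ.* suc i
  position -[1+ i ] = 1 ℕ.+ 4 ℕ.* suc i

  position-upper : ∀ z → position z ℕ.≤ 1 ℕ.+ 4 ℕ.* ∣ z ∣
  position-upper (+ zero) = ℕP.≤-refl
  position-upper (+ suc i) = ℕP.n≤1+n _
  position-upper -[1+ i ] = ℕP.≤-refl

  position-lower : ∀ z → 4 ℕ.* ∣ z ∣ ℕ.≤ position z
  position-lower (+ zero) = z≤n
  position-lower (+ suc i) = ℕP.≤-refl
  position-lower -[1+ i ] = ℕP.n≤1+n _

  position-< : ∀ {z z′} → ∣ z ∣ ℕ.< ∣ z′ ∣ → position z ℕ.< position z′
  position-< {z} {z′} lt =
    ℕP.≤-<-trans (position-upper z) (ℕP.<-≤-trans (append-< 4 (s≤s (s≤s z≤n)) lt) (position-lower z′))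

  position-+<- : ∀ {i j} → i ℕ.≤ j → position (+ suc i) ℕ.< position -[1+ j ]
  position-+<- i≤j = s≤s (ℕP.*-monoʳ-≤ 4 (s≤s i≤j))

  ∣p⁻∣ : ∀ c → ∣ p⁻ c ∣ ≡ c ℕ.+ c
  ∣p⁻∣ c = ℤP.∣-i∣≡∣i∣ (+ (c ℕ.+ c))

  p⁺-earlier : ∀ c z → suc (c ℕ.+ c) ℕ.< ∣ z ∣ → position (p⁺ c) ℕ.< position z
  p⁺-earlier c z = position-< {p⁺ c} {z}

  p⁻-earlier : ∀ c z → c ℕ.+ c ℕ.< ∣ z ∣ → position (p⁻ c) ℕ.< position z
  p⁻-earlier c z lt = position-< {p⁻ c} {z} (subst (ℕ._< ∣ z ∣) (sym (∣p⁻∣ c)) lt)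

  CompletesAPᶻ : ℤ → Set
  CompletesAPᶻ z = Σ ℤ λ a → Σ ℤ λ b → InP a × InP b ×
    position a ℕ.< position z × position b ℕ.< position z × z + a ≡ b + b × a ≢ b

  last-term-largest : ∀ {n a b} → n ℕ.+ a ≡ b ℕ.+ b → a ℕ.< b → b ℕ.< n
  last-term-largest eq a<b = ℕP.≰⇒> (λ n≤b → ℕP.<-irrefl eq (ℕP.+-mono-≤-< n≤b a<b))

  -- the greedy alternative for the four kinds of integers 1 + 2m, -2m, 2 + 2m, -(1 + 2m);
  -- for 1 + 2m and -2m it is the greedy alternative for m in ℕ
  positive-odd : ∀ m → InP (p⁺ m) ⊎ CompletesAPᶻ (p⁺ m)
  positive-odd m with cantor-or-completes m
  ... | inj₁ cm = inj₁ (m , cm , inj₁ refl)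
  ... | inj₂ (a , b , ca , cb , a<b , ap) =
    inj₂ (p⁺ a , p⁺ b , (a , ca , inj₁ refl) , (b , cb , inj₁ refl) ,
          p⁺-earlier a (p⁺ m) (s≤s (ℕP.+-mono-< a<m a<m)) , p⁺-earlier b (p⁺ m) (s≤s (ℕP.+-mono-< b<m b<m)) ,
          p⁺-AP m b a ap , λ eq → ℕP.<-irrefl (p⁺-injective a b eq) a<b)
    where
    b<m = last-term-largest ap a<b
    a<m = ℕP.<-trans a<b b<m

  nonpositive-even : ∀ m → InP (p⁻ m) ⊎ CompletesAPᶻ (p⁻ m)
  nonpositive-even m with cantor-or-completes m
  ... | inj₁ cm = inj₁ (m , cm , inj₂ refl)
  ... | inj₂ (a , b , ca , cb , a<b , ap) =
    inj₂ (p⁻ a , p⁻ b , (a , ca , inj₂ refl) , (b , cb , inj₂ refl) ,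
          earlier a<m , earlier b<m , p⁻-AP m b a ap , λ eq → ℕP.<-irrefl (p⁻-injective a b eq) a<b)
    where
    b<m = last-term-largest ap a<b
    a<m = ℕP.<-trans a<b b<m
    earlier : ∀ {x} → x ℕ.< m → position (p⁻ x) ℕ.< position (p⁻ m)
    earlier {x} x<m = p⁻-earlier x (p⁻ m) (subst (x ℕ.+ x ℕ.<_) (sym (∣p⁻∣ m)) (ℕP.+-mono-< x<m x<m))

  -- 2 + 2m with m = 2b + a completes the 3-AP -2a, 1 + 2b, 2 + 2m
  positive-even : ∀ m → CompletesAPᶻ (+ suc (suc (m ℕ.+ m)))
  positive-even m with twice-plus m
  ... | a , b , ca , cb , refl =
    p⁻ a , p⁺ b , (a , ca , inj₂ refl) , (b , cb , inj₁ refl) ,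
    p⁻-earlier a z (s≤s (ℕP.m≤n⇒m≤1+n (ℕP.+-mono-≤ a≤m a≤m))) , p⁺-earlier b z (s≤s (s≤s (ℕP.+-mono-≤ b≤m b≤m))) ,
    ap (+ a) (+ b) , λ eq → p⁺≢p⁻ b a (sym eq)
    where
    z = + suc (suc (m ℕ.+ m))
    a≤m = ℕP.m≤n+m a (b ℕ.+ b)
    b≤m = ℕP.≤-trans (ℕP.m≤m+n b b) (ℕP.m≤m+n (b ℕ.+ b) a)
    ap : ∀ x y → (+ 1 + (+ 1 + ((y + y + x) + (y + y + x)))) + - (x + x) ≡ (+ 1 + (y + y)) + (+ 1 + (y + y))
    ap = solve-∀

  -- -(1 + 2m) with m = 2b + a completes the 3-AP 1 + 2a, -2b, -(1 + 2m)
  negative-odd : ∀ m → CompletesAPᶻ -[1+ m ℕ.+ m ]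
  negative-odd m with twice-plus m
  ... | a , b , ca , cb , refl =
    p⁺ a , p⁻ b , (a , ca , inj₁ refl) , (b , cb , inj₂ refl) ,
    position-+<- (ℕP.+-mono-≤ a≤m a≤m) , p⁻-earlier b -[1+ m ℕ.+ m ] (s≤s (ℕP.≤-trans bb≤m (ℕP.m≤m+n m m))) ,
    ap (+ a) (+ b) , λ eq → p⁺≢p⁻ a b eq
    where
    a≤m = ℕP.m≤n+m a (b ℕ.+ b)
    bb≤m = ℕP.m≤m+n (b ℕ.+ b) a
    ap : ∀ x y → - (+ 1 + ((y + y + x) + (y + y + x))) + (+ 1 + (x + x)) ≡ - (y + y) + - (y + y)
    ap = solve-∀

  P-or-completes : ∀ z → InP z ⊎ CompletesAPᶻ z
  P-or-completes (+ zero) = nonpositive-even 0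
  P-or-completes (+ suc k) with parity-split k
  ... | m , inj₁ refl = positive-odd m
  ... | m , inj₂ refl = inj₂ (positive-even m)
  P-or-completes -[1+ k ] with parity-split k
  ... | m , inj₁ refl = inj₂ (negative-odd m)
  ... | m , inj₂ refl = subst (λ z → InP z ⊎ CompletesAPᶻ z) (cong -[1+_] (ℕP.+-suc m m)) (nonpositive-even (suc m))

module Progressions where

  open Words
  open Isometry
  open GreedyInℤ
  import Data.Nat as ℕ
  open import Data.Integer using (ℤ; +_; -[1+_]; _+_; -_; _-_)
  import Data.Integer.Properties as ℤP
  open import Data.Integer.Tactic.RingSolver using (solve-∀)
  open import Data.Bool using (true; false)
  open import Data.List using (List)
  open import Data.Product using (Σ; _×_; _,_; proj₂)
  open import Data.Sum using (inj₁; inj₂)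
  open import Relation.Nullary using (¬_)
  open import Relation.Binary.PropositionalEquality
  open ≡-Reasoning

  translation : ℤ → List Letter
  translation z = word (false , z)

  InTP : Subset
  InTP u = Σ ℤ λ z → InP z × u ≡ translation z

  Reflection : List Letter → Set
  Reflection v = Σ ℤ λ c → v ≡ word (true , c)

  translation-· : ∀ α ρ → translation α · translation ρ ≡ translation (ρ + α)
  translation-· α ρ = reduced-unique (reduced-· (translation α) (translation ρ) (reduced-word (false , ρ)))
    (begin
      ⟦ translation α · translation ρ ⟧         ≡⟨ ⟦·⟧ (translation α) (translation ρ) ⟩
      ⟦ translation α ⟧ ⊙ ⟦ translation ρ ⟧     ≡⟨ cong₂ _⊙_ (⟦word⟧ (false , α)) (⟦word⟧ (false , ρ)) ⟩
      (false , ρ + α)                           ∎)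

  twice≡0 : ∀ ρ → ρ + ρ ≡ + 0 → ρ ≡ + 0
  twice≡0 (+ ℕ.zero) _ = refl
  twice≡0 (+ ℕ.suc n) eq with ℤP.+-injective eq
  ... | ()
  twice≡0 -[1+ n ] ()

  P-step-trivial : ∀ α ρ → InP α → InP (ρ + α) → InP (ρ + (ρ + α)) → ρ ≡ + 0
  P-step-trivial α ρ pα pβ pγ = twice≡0 ρ (begin
    ρ + ρ                     ≡⟨ shift α ρ ⟩
    (ρ + (ρ + α)) - α         ≡⟨ cong (_- α) (sym α≡γ) ⟩
    α - α                     ≡⟨ ℤP.+-inverseʳ α ⟩
    + 0                       ∎)
    where
    ap : ∀ α ρ → α + (ρ + (ρ + α)) ≡ (ρ + α) + (ρ + α)
    ap = solve-∀
    shift : ∀ α ρ → ρ + ρ ≡ (ρ + (ρ + α)) - α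
    shift = solve-∀
    α≡γ = P-AP-free pα pβ pγ (ap α ρ)

  ratio-trivial : ∀ {α β γ} f → InP α → InP β → InP γ →
                  (false , α) ⊙ f ≡ (false , β) → (false , β) ⊙ f ≡ (false , γ) → f ≡ idᴵ
  ratio-trivial (true , ρ) _ _ _ () _
  ratio-trivial {α} (false , ρ) pα pβ pγ refl refl = cong (false ,_) (P-step-trivial α ρ pα pβ pγ)

  -- if v and all of S are translations by elements of P, then v forms no GP with
  -- S: the isometries of a, ar, ar² are translations in P, so r denotes the identity
  P-GP-free : ∀ (S : Subset) v → InTP v → (∀ u → S u → InTP u) → ¬ FormsGP S v
  P-GP-free S v tv tS (a , r , _ , red-r , r≢I , _ , a∈ , ar∈ , arr∈) = r≢I (reduced-unique red-r ⟦r⟧≡id)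
    where
    member : ∀ {u} → (S ∪﹛ v ﹜) u → InTP u
    member (inj₁ s) = tS _ s
    member (inj₂ refl) = tv
    denotes : ∀ {u} → (S ∪﹛ v ﹜) u → Σ ℤ λ z → InP z × ⟦ u ⟧ ≡ (false , z)
    denotes u∈ with member u∈
    ... | z , pz , refl = z , pz , ⟦word⟧ (false , z)
    ⟦r⟧≡id : ⟦ r ⟧ ≡ idᴵ
    ⟦r⟧≡id with denotes a∈ | denotes ar∈ | denotes arr∈
    ... | α , pα , ⟦a⟧ | β , pβ , ⟦ar⟧ | γ , pγ , ⟦arr⟧ = ratio-trivial ⟦ r ⟧ pα pβ pγ
      (trans (cong (_⊙ ⟦ r ⟧) (sym ⟦a⟧)) (trans (sym (⟦·⟧ a r)) ⟦ar⟧))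
      (trans (cong (_⊙ ⟦ r ⟧) (sym ⟦ar⟧)) (trans (sym (⟦·⟧ (a · r) r)) ⟦arr⟧))

  reflection-squared : ∀ c → word (true , c) · word (true , c) ≡ I
  reflection-squared c = reduced-unique (reduced-· v v (reduced-word (true , c))) (begin
    ⟦ v · v ⟧              ≡⟨ ⟦·⟧ v v ⟩
    ⟦ v ⟧ ⊙ ⟦ v ⟧          ≡⟨ cong (λ f → f ⊙ f) (⟦word⟧ (true , c)) ⟩
    (false , - c + c)      ≡⟨ cong (false ,_) (ℤP.+-inverseˡ c) ⟩
    idᴵ                    ∎)
    where
    v = word (true , c)

  reflection≢I : ∀ c → word (true , c) ≢ I
  reflection≢I (+ _) ()
  reflection≢I -[1+ _ ] ()

  -- with a = r = v:  v, v·v = I, v·v·v = v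
  reflection-forms-GP : ∀ (S : Subset) {v} → S I → Reflection v → FormsGP S v
  reflection-forms-GP S sI (c , refl) =
    v , v , reduced-word (true , c) , reduced-word (true , c) , reflection≢I c , inj₁ refl ,
    inj₂ refl , inj₁ (subst S (sym (reflection-squared c)) sI) , inj₂ (cong (_· v) (reflection-squared c))
    where
    v = word (true , c)

  -- with a = translation α and r = translation (β - α):  a·r = translation β, a·r·r = translation z
  completes-forms-GP : ∀ (S : Subset) z → CompletesAPᶻ z →
                       (∀ y → InP y → position y ℕ.< position z → S (translation y)) → FormsGP S (translation z)
  completes-forms-GP S z (α , β , pα , pβ , α< , β< , ap , α≢β) earlier =
    translation α , translation ρ , reduced-word (false , α) , reduced-word (false , ρ) , ρ≢0 ,
    inj₂ (inj₂ (sym ar²≡z)) , inj₁ (earlier α pα α<) , inj₁ (subst S (sym ar≡β) (earlier β pβ β<)) , inj₂ ar²≡z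
    where
    ρ = β - α
    sub-add : ∀ α β → (β - α) + α ≡ β
    sub-add = solve-∀
    ar≡β : translation α · translation ρ ≡ translation β
    ar≡β = trans (translation-· α ρ) (cong translation (sub-add α β))
    ar²≡z : translation α · translation ρ · translation ρ ≡ translation z
    ar²≡z = begin
      translation α · translation ρ · translation ρ   ≡⟨ cong (_· translation ρ) ar≡β ⟩
      translation β · translation ρ                   ≡⟨ translation-· β ρ ⟩
      translation (ρ + β)                             ≡⟨ cong translation (last-term α β z ap) ⟩
      translation z                                   ∎
      where
      last-term : ∀ α β z → z + α ≡ β + β → (β - α) + β ≡ z
      last-term α β z eq = trans (rearrange α β) (trans (cong (_- α) (sym eq)) (cancel α z))
        where
        rearrange : ∀ α β → (β - α) + β ≡ (β + β) - α
        rearrange = solve-∀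
        cancel : ∀ α z → (z + α) - α ≡ z
        cancel = solve-∀
    ρ≢0 : translation ρ ≢ I
    ρ≢0 eq = α≢β (begin
      α            ≡⟨ sym (ℤP.+-identityˡ α) ⟩
      + 0 + α      ≡⟨ cong (_+ α) (sym ρ≡0) ⟩
      ρ + α        ≡⟨ sub-add α β ⟩
      β            ∎)
      where
      ρ≡0 : ρ ≡ + 0
      ρ≡0 = cong proj₂ (trans (sym (⟦word⟧ (false , ρ))) (cong ⟦_⟧ eq))

-- The enumeration W = (w 1, w 2, …) = (I, x, y, xy, yx, …): w (4q) and
-- w (4q + 1) are translations, w (4q + 2) and w (4q + 3) reflections.
module Enumeration where

  open Parity
  open Isometry
  open CantorNumbers using (base-expansion)
  open GreedyInℤ using (position)
  open Progressions using (translation; Reflection)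
  open import Data.Nat using (ℕ; zero; suc; _+_; _*_; _≤_; _<_; s≤s; ⌊_/2⌋)
  open import Data.Nat.Properties using (+-suc; +-identityʳ)
  open import Data.Nat.DivMod using (_%_; _/_; m%n<n)
  open import Data.Nat.Tactic.RingSolver using (solve-∀)
  open import Data.Integer using (ℤ; +_; -[1+_])
  open import Data.Product using (Σ; _,_)
  open import Data.Sum using (_⊎_; inj₁; inj₂)
  open import Relation.Binary.PropositionalEquality
  open ≡-Reasoning

  four-more : ∀ r q → r + 4 * suc q ≡ 4 + (r + 4 * q)
  four-more = solve-∀

  parity-+4 : ∀ r q → parity (r + 4 * q) ≡ parity r
  parity-+4 r zero = cong parity (+-identityʳ r)
  parity-+4 r (suc q) = trans (cong parity (four-more r q)) (parity-+4 r q)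

  half-+4 : ∀ r q → ⌊ r + 4 * q /2⌋ ≡ ⌊ r /2⌋ + double q
  half-+4 r zero = trans (cong ⌊_/2⌋ (+-identityʳ r)) (sym (+-identityʳ ⌊ r /2⌋))
  half-+4 r (suc q) = begin
    ⌊ r + 4 * suc q /2⌋                ≡⟨ cong ⌊_/2⌋ (four-more r q) ⟩
    suc (suc ⌊ r + 4 * q /2⌋)          ≡⟨ cong (λ n → suc (suc n)) (half-+4 r q) ⟩
    suc (suc (⌊ r /2⌋ + double q))     ≡⟨ cong suc (sym (+-suc ⌊ r /2⌋ (double q))) ⟩
    suc (⌊ r /2⌋ + suc (double q))     ≡⟨ sym (+-suc ⌊ r /2⌋ (suc (double q))) ⟩
    ⌊ r /2⌋ + double (suc q)           ∎

  w-+4 : ∀ r q → w (r + 4 * q) ≡ alt (parity r) (⌊ r /2⌋ + double q)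
  w-+4 r q = cong₂ alt (parity-+4 r q) (half-+4 r q)

  w-position : ∀ z → w (position z) ≡ translation z
  w-position (+ zero) = refl
  w-position (+ suc i) = w-+4 0 (suc i)
  w-position -[1+ i ] = w-+4 1 (suc i)

  Classified : ℕ → Set
  Classified j = (Σ ℤ λ z → position z ≡ j) ⊎ Reflection (w j)

  w-classify : ∀ j → 1 ≤ j → Classified j
  w-classify j 1≤j = subst Classified (sym (base-expansion j 4))
    (by-residue (j % 4) (j / 4) (m%n<n j 4) (subst (1 ≤_) (base-expansion j 4) 1≤j))
    where
    by-residue : ∀ r q → r < 4 → 1 ≤ r + 4 * q → Classified (r + 4 * q)
    by-residue 0 zero _ ()
    by-residue 0 (suc i) _ _ = inj₁ (+ suc i , refl)
    by-residue 1 zero _ _ = inj₁ (+ 0 , refl)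
    by-residue 1 (suc i) _ _ = inj₁ (-[1+ i ] , refl)
    by-residue 2 q _ _ = inj₂ (+ q , w-+4 2 q)
    by-residue 3 q _ _ = inj₂ (-[1+ q ] , w-+4 3 q)
    by-residue (suc (suc (suc (suc _)))) q (s≤s (s≤s (s≤s (s≤s ())))) _

-- G consists exactly of the translations by elements of P.  By induction on
-- m, G_m consists of the translations by elements z ∈ P with position z ≤ m:
-- a reflection is never added (it forms a GP with I), a translation by z ∈ P
-- is added (P-GP-free), and one by z ∉ P is not (completes-forms-GP).
module Characterisation where

  open GreedyInℤ
  open Progressions
  open Enumeration
  open import Data.Nat as ℕ using (ℕ; zero; suc; z≤n; s≤s)
  import Data.Nat.Properties as ℕP
  open import Data.Integer using (ℤ; +_; -[1+_])
  open import Data.Product using (Σ; _×_; _,_)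
  open import Data.Sum using (inj₁; inj₂)
  open import Data.Empty using (⊥-elim)
  open import Function.Bundles using (_⇔_; mk⇔; Equivalence)
  open Equivalence using (to; from)
  open import Relation.Binary.PropositionalEquality

  InitialTP : ℕ → Subset
  InitialTP m u = Σ ℤ λ z → InP z × position z ℕ.≤ m × u ≡ translation z

  P0 : InP (+ 0)
  P0 = 0 , CantorNumbers.none , inj₂ refl

  position≥1 : ∀ z → 1 ℕ.≤ position z
  position≥1 (+ zero) = s≤s z≤n
  position≥1 (+ suc i) = s≤s z≤n
  position≥1 -[1+ i ] = s≤s z≤n

  position≤1 : ∀ z → position z ℕ.≤ 1 → z ≡ + 0
  position≤1 (+ zero) _ = refl
  position≤1 (+ suc i) le with ℕP.≤-trans (ℕP.*-monoʳ-≤ 4 (s≤s (z≤n {i}))) le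
  ... | s≤s ()
  position≤1 -[1+ i ] (s≤s ())

  Gm-characterisation : ∀ m u → Gm (suc m) u ⇔ InitialTP (suc m) u
  Gm-characterisation zero u = mk⇔ (λ u≡I → + 0 , P0 , ℕP.≤-refl , u≡I)
    (λ { (z , _ , le , u≡) → trans u≡ (cong translation (position≤1 z le)) })
  Gm-characterisation (suc m) u = mk⇔ forward backward
    where
    S = Gm (suc m)
    IH = λ v → Gm-characterisation m v
    in-S : ∀ z → InP z → position z ℕ.≤ suc m → S (translation z)
    in-S z pz le = from (IH (translation z)) (z , pz , le , refl)
    S⊆TP : ∀ v → S v → InTP v
    S⊆TP v s with to (IH v) s
    ... | z , pz , _ , v≡ = z , pz , v≡
    j = suc (suc m)
    w-at : ∀ z → position z ≡ j → w j ≡ translation z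
    w-at z at-j = trans (cong w (sym at-j)) (w-position z)
    forward : Gm j u → InitialTP j u
    forward (inj₁ s) with to (IH u) s
    ... | z , pz , le , u≡ = z , pz , ℕP.m≤n⇒m≤1+n le , u≡
    forward (inj₂ (refl , no-GP)) with w-classify j (s≤s z≤n)
    ... | inj₂ reflection = ⊥-elim (no-GP (reflection-forms-GP S (in-S (+ 0) P0 (s≤s z≤n)) reflection))
    ... | inj₁ (z , at-j) with P-or-completes z
    ...   | inj₁ pz = z , pz , ℕP.≤-reflexive at-j , w-at z at-j
    ...   | inj₂ completes = ⊥-elim (no-GP (subst (FormsGP S) (sym (w-at z at-j))
              (completes-forms-GP S z completes (λ y py lt → in-S y py (ℕP.≤-pred (subst (position y ℕ.<_) at-j lt))))))
    backward : InitialTP j u → Gm j u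
    backward (z , pz , le , u≡) with ℕP.m≤n⇒m<n∨m≡n le
    ... | inj₁ lt = inj₁ (from (IH u) (z , pz , ℕP.≤-pred lt , u≡))
    ... | inj₂ at-j = inj₂ (trans u≡ (sym (w-at z at-j)) ,
            P-GP-free S (w j) (z , pz , w-at z at-j) S⊆TP)

  G-characterisation : ∀ u → G u ⇔ InTP u
  G-characterisation u = mk⇔ forward backward
    where
    forward : G u → InTP u
    forward (zero , ())
    forward (suc m , g) with to (Gm-characterisation m u) g
    ... | z , pz , _ , u≡ = z , pz , u≡
    backward : InTP u → G u
    backward (z , pz , u≡) = at (position z) ℕP.≤-refl (position≥1 z)
      where
      at : ∀ n → position z ℕ.≤ n → 1 ℕ.≤ n → G u
      at zero _ ()
      at (suc k) le _ = suc k , from (Gm-characterisation k u) (z , pz , le , u≡)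

module Counting where

  open import Data.Nat using (ℕ; suc; _≤_; s≤s; z≤n)
  open import Data.Nat.Properties using (≤-trans; ≤-reflexive; +-suc)
  open import Data.List using (List; []; _∷_; length; _++_; filter)
  open import Data.List.Properties using (length-++)
  open import Data.List.Membership.Propositional using (_∈_)
  open import Data.List.Membership.Propositional.Properties using (∈-++⁺ˡ; ∈-++⁺ʳ; ∈-++⁻; ∈-∃++; ∈-filter⁺; ∈-filter⁻)
  open import Data.List.Relation.Unary.Any using (here; there)
  import Data.List.Relation.Unary.All as All
  open import Data.List.Relation.Unary.AllPairs using (_∷_)
  open import Data.List.Relation.Unary.Unique.Propositional using (Unique)
  import Data.List.Relation.Unary.Unique.Propositional.Properties as Unique
  open import Data.Product using (Σ; _×_; _,_)
  open import Data.Sum using (inj₁; inj₂)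
  open import Data.Empty using (⊥-elim)
  open import Function.Bundles using (_⇔_; mk⇔; Equivalence)
  open Equivalence using (to; from)
  open import Relation.Nullary using (Dec)
  open import Relation.Binary.PropositionalEquality

  unique-⊆-length : ∀ {A : Set} {xs ys : List A} → Unique xs → (∀ {u} → u ∈ xs → u ∈ ys) → length xs ≤ length ys
  unique-⊆-length {xs = []} _ _ = z≤n
  unique-⊆-length {xs = x ∷ xs} {ys} (x∉xs ∷ unique-xs) xs⊆ys with ∈-∃++ (xs⊆ys (here refl))
  ... | us , vs , refl = ≤-trans (s≤s (unique-⊆-length unique-xs xs⊆us++vs)) (≤-reflexive (sym length-removed))
    where
    xs⊆us++vs : ∀ {u} → u ∈ xs → u ∈ us ++ vs
    xs⊆us++vs {u} u∈xs with ∈-++⁻ us (xs⊆ys (there u∈xs))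
    ... | inj₁ u∈us = ∈-++⁺ˡ u∈us
    ... | inj₂ (here u≡x) = ⊥-elim (All.lookup x∉xs u∈xs (sym u≡x))
    ... | inj₂ (there u∈vs) = ∈-++⁺ʳ us u∈vs
    length-removed : length (us ++ x ∷ vs) ≡ suc (length (us ++ vs))
    length-removed = trans (length-++ us) (trans (+-suc (length us) (length vs)) (cong suc (sym (length-++ us))))

  count-mono : ∀ {P Q : Subset} {a b} → (∀ u → P u → Q u) → CountIs P a → CountIs Q b → a ≤ b
  count-mono P⊆Q (xs , unique-xs , ∈xs , refl) (ys , _ , ∈ys , refl) =
    unique-⊆-length unique-xs (λ {u} u∈xs → from (∈ys u) (P⊆Q u (to (∈xs u) u∈xs)))

  count-restrict : ∀ {P Q R : Subset} {b} → (∀ u → Dec (R u)) → (∀ u → P u ⇔ (Q u × R u)) →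
                   CountIs Q b → Σ ℕ λ a → CountIs P a
  count-restrict R? P⇔ (ys , unique-ys , ∈ys , _) =
    length (filter R? ys) , filter R? ys , Unique.filter⁺ R? unique-ys ,
    (λ u → mk⇔ (λ u∈ → let (u∈ys , r) = ∈-filter⁻ R? u∈ in from (P⇔ u) (to (∈ys u) u∈ys , r))
               (λ pu → let (q , r) = to (P⇔ u) pu in ∈-filter⁺ R? (from (∈ys u) q) r)) ,
    refl

module BallCounts where

  open Parity
  open Words
  open Isometry
  open CantorNumbers
  open GreedyInℤ
  open Progressions using (translation)
  open Characterisation using (G-characterisation)
  open import Data.Nat using (ℕ; zero; suc; _+_; _*_; _^_; _≤_; _<_; z≤n)
  open import Data.Nat.Properties
  open import Data.Integer using (ℤ; +_; -[1+_]; ∣_∣)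
  open import Data.Bool using (false)
  open import Data.List using (List; []; _∷_; length; map; _++_)
  open import Data.List.Properties using (length-map; length-++)
  open import Data.List.Membership.Propositional using (_∈_)
  open import Data.List.Membership.Propositional.Properties using (∈-map⁺; ∈-map⁻; ∈-++⁺ˡ; ∈-++⁺ʳ; ∈-++⁻)
  open import Data.List.Relation.Unary.Any using (here; there)
  import Data.List.Relation.Unary.All as All
  open import Data.List.Relation.Unary.AllPairs using ([]; _∷_)
  open import Data.List.Relation.Unary.Unique.Propositional using (Unique)
  import Data.List.Relation.Unary.Unique.Propositional.Properties as Unique
  open import Data.Product using (_×_; _,_; proj₂)
  open import Data.Sum using (inj₁; inj₂)
  open import Data.Unit using (tt)
  open import Function.Bundles using (mk⇔; Equivalence)
  open Equivalence using (to; from)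
  open import Relation.Nullary using (¬_)
  open import Relation.Binary.PropositionalEquality

  ball-list : ℕ → List (List Letter)
  ball-list zero = [] ∷ []
  ball-list (suc N) = alt 𝑥 (suc N) ∷ alt 𝑦 (suc N) ∷ ball-list N

  ∈-ball-list⁻ : ∀ N {u} → u ∈ ball-list N → Ball N u
  ∈-ball-list⁻ zero (here refl) = tt , z≤n
  ∈-ball-list⁻ (suc N) (here refl) = reduced-alt 𝑥 (suc N) , ≤-reflexive (length-alt 𝑥 (suc N))
  ∈-ball-list⁻ (suc N) (there (here refl)) = reduced-alt 𝑦 (suc N) , ≤-reflexive (length-alt 𝑦 (suc N))
  ∈-ball-list⁻ (suc N) (there (there u∈)) with ∈-ball-list⁻ N u∈
  ... | red , le = red , m≤n⇒m≤1+n le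

  alt-∈-ball-list : ∀ N l n → n ≤ N → alt l n ∈ ball-list N
  alt-∈-ball-list zero l zero _ = here refl
  alt-∈-ball-list (suc N) l n le with m≤n⇒m<n∨m≡n le
  ... | inj₁ lt = there (there (alt-∈-ball-list N l n (≤-pred lt)))
  alt-∈-ball-list (suc N) 𝑥 n le | inj₂ refl = here refl
  alt-∈-ball-list (suc N) 𝑦 n le | inj₂ refl = there (here refl)

  ∈-ball-list⁺ : ∀ N {u} → Ball N u → u ∈ ball-list N
  ∈-ball-list⁺ N {u} (red , le) with reduced-alternates u red
  ... | l , u≡ = subst (_∈ ball-list N) (sym u≡) (alt-∈-ball-list N l (length u) le)

  longer-than-ball : ∀ N l {v} → v ∈ ball-list N → alt l (suc N) ≢ v
  longer-than-ball N l v∈ refl with ∈-ball-list⁻ N v∈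
  ... | _ , le = <-irrefl refl (≤-trans (≤-reflexive (sym (length-alt l (suc N)))) le)

  unique-ball-list : ∀ N → Unique (ball-list N)
  unique-ball-list zero = All.[] ∷ []
  unique-ball-list (suc N) =
    ((λ ()) All.∷ All.tabulate (longer-than-ball N 𝑥)) ∷ (All.tabulate (longer-than-ball N 𝑦) ∷ unique-ball-list N)

  length-ball-list : ∀ N → length (ball-list N) ≡ suc (N + N)
  length-ball-list zero = refl
  length-ball-list (suc N) = cong (λ n → suc (suc n)) (trans (length-ball-list N) (sym (+-suc N N)))

  count-ball : ∀ N → CountIs (Ball N) (suc (N + N))
  count-ball N = ball-list N , unique-ball-list N , (λ u → mk⇔ (∈-ball-list⁻ N) (∈-ball-list⁺ N)) , length-ball-list N

  length-translation : ∀ z → length (translation z) ≡ 2 * ∣ z ∣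
  length-translation z = trans (by-sign z) (trans (double≡+ ∣ z ∣) (cong (λ n → ∣ z ∣ + n) (sym (+-identityʳ ∣ z ∣))))
    where
    by-sign : ∀ z → length (translation z) ≡ double ∣ z ∣
    by-sign (+ i) = length-alt 𝑥 (double i)
    by-sign -[1+ i ] = length-alt 𝑦 (double (suc i))

  translation-injective : ∀ {α β} → translation α ≡ translation β → α ≡ β
  translation-injective {α} {β} eq = cong proj₂ (begin
    (false , α)              ≡⟨ sym (⟦word⟧ (false , α)) ⟩
    ⟦ translation α ⟧        ≡⟨ cong ⟦_⟧ eq ⟩
    ⟦ translation β ⟧        ≡⟨ ⟦word⟧ (false , β) ⟩
    (false , β)              ∎)
    where open ≡-Reasoning

  half-below : ∀ {c M} → 0 < M → c + c ≤ M → c < M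
  half-below {c} {M} 0<M cc≤M = ≰⇒> (λ M≤c → <-irrefl refl (begin-strict
    M       <⟨ m<m+n M 0<M ⟩
    M + M   ≤⟨ +-mono-≤ M≤c M≤c ⟩
    c + c   ≤⟨ cc≤M ⟩
    M       ∎))
    where open ≤-Reasoning

  -- the elements of P of absolute value at most 3^k
  P-below : ℕ → List ℤ
  P-below k = map p⁺ (cantor-below k) ++ map p⁻ (cantor-below k)

  ∈-P-below⁻ : ∀ k {z} → z ∈ P-below k → InP z × ∣ z ∣ ≤ 3 ^ k
  ∈-P-below⁻ k z∈ with ∈-++⁻ (map p⁺ (cantor-below k)) z∈
  ... | inj₁ z∈⁺ with ∈-map⁻ p⁺ z∈⁺
  ...   | c , c∈ , refl with ∈-cantor-below⁻ k c∈
  ...     | cc , c< = (c , cc , inj₁ refl) , cantor-bound k cc c<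
  ∈-P-below⁻ k z∈ | inj₂ z∈⁻ with ∈-map⁻ p⁻ z∈⁻
  ...   | c , c∈ , refl with ∈-cantor-below⁻ k c∈
  ...     | cc , c< = (c , cc , inj₂ refl) , subst (_≤ 3 ^ k) (sym (∣p⁻∣ c)) (<⇒≤ (cantor-bound k cc c<))

  ∈-P-below⁺ : ∀ k {z} → InP z → ∣ z ∣ ≤ 3 ^ k → z ∈ P-below k
  ∈-P-below⁺ k (c , cc , inj₁ refl) le =
    ∈-++⁺ˡ (∈-map⁺ p⁺ (∈-cantor-below⁺ k cc (half-below (m^n>0 3 k) (≤-trans (n≤1+n (c + c)) le))))
  ∈-P-below⁺ k (c , cc , inj₂ refl) le =
    ∈-++⁺ʳ (map p⁺ (cantor-below k)) (∈-map⁺ p⁻ (∈-cantor-below⁺ k cc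
      (half-below (m^n>0 3 k) (subst (_≤ 3 ^ k) (∣p⁻∣ c) le))))

  unique-P-below : ∀ k → Unique (P-below k)
  unique-P-below k = Unique.++⁺ (Unique.map⁺ (p⁺-injective _ _) (unique-cantor-below k))
    (Unique.map⁺ (p⁻-injective _ _) (unique-cantor-below k)) disjoint
    where
    disjoint : ∀ {z} → ¬ (z ∈ map p⁺ (cantor-below k) × z ∈ map p⁻ (cantor-below k))
    disjoint (z∈⁺ , z∈⁻) with ∈-map⁻ p⁺ z∈⁺ | ∈-map⁻ p⁻ z∈⁻
    ... | a , _ , refl | b , _ , eq = p⁺≢p⁻ a b eq

  length-P-below : ∀ k → length (P-below k) ≡ 2 ^ k + 2 ^ k
  length-P-below k = trans (length-++ (map p⁺ (cantor-below k)))
    (cong₂ _+_ (trans (length-map p⁺ (cantor-below k)) (length-cantor-below k))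
               (trans (length-map p⁻ (cantor-below k)) (length-cantor-below k)))

  count-G∩Ball : ∀ k → CountIs (G∩Ball (2 * 3 ^ k)) (2 ^ k + 2 ^ k)
  count-G∩Ball k = map translation (P-below k) ,
    Unique.map⁺ translation-injective (unique-P-below k) ,
    (λ u → mk⇔ to-G∩Ball from-G∩Ball) ,
    trans (length-map translation (P-below k)) (length-P-below k)
    where
    to-G∩Ball : ∀ {u} → u ∈ map translation (P-below k) → G∩Ball (2 * 3 ^ k) u
    to-G∩Ball u∈ with ∈-map⁻ translation u∈
    ... | z , z∈ , refl with ∈-P-below⁻ k z∈
    ...   | pz , le = from (G-characterisation (translation z)) (z , pz , refl) , reduced-word (false , z) ,
                      subst (_≤ 2 * 3 ^ k) (sym (length-translation z)) (*-monoʳ-≤ 2 le)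
    from-G∩Ball : ∀ {u} → G∩Ball (2 * 3 ^ k) u → u ∈ map translation (P-below k)
    from-G∩Ball {u} (gu , _ , le) with to (G-characterisation u) gu
    ... | z , pz , refl = ∈-map⁺ translation (∈-P-below⁺ k pz
           (*-cancelˡ-≤ 2 (subst (_≤ 2 * 3 ^ k) (length-translation z) le)))

open Counting
open BallCounts using (count-ball; count-G∩Ball)
open import Data.Nat using (ℕ; zero; suc; _+_; _*_; _^_; _≤_; _<_; _≤?_; z≤n; s≤s)
open import Data.Nat.Properties
open import Data.Nat.Tactic.RingSolver using (solve-∀)
open import Data.List using (length)
open import Data.Product using (Σ; _×_; _,_)
open import Data.Empty using (⊥-elim)
open import Function.Bundles using (_⇔_; mk⇔)
open import Relation.Binary.PropositionalEquality using (_≡_; refl; cong; trans; subst)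

G∩Ball-mono : ∀ {M N} → M ≤ N → ∀ u → G∩Ball M u → G∩Ball N u
G∩Ball-mono M≤N u (gu , red , le) = gu , red , ≤-trans le M≤N

density-at-powers : (n : ℕ) → Σ ℕ λ g → Σ ℕ λ b →
  CountIs (G∩Ball (2 * 3 ^ n)) g × CountIs (Ball (2 * 3 ^ n)) b × g * (1 + 4 * 3 ^ n) ≡ 2 ^ (n + 1) * b
density-at-powers n = 2 ^ (n + 1) , 1 + 4 * 3 ^ n ,
  subst (CountIs _) (trans (double (2 ^ n)) (cong (2 ^_) (+-comm 1 n))) (count-G∩Ball n) ,
  subst (CountIs _) (four-times (3 ^ n)) (count-ball (2 * 3 ^ n)) ,
  refl
  where
  double : ∀ x → x + x ≡ 2 * x
  double = solve-∀
  four-times : ∀ x → suc (2 * x + 2 * x) ≡ 1 + 4 * x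
  four-times = solve-∀

ratio-bounds : ∀ {L g n b} → L ≤ g → g ≤ 4 * L → n ≤ b → b ≤ 3 * n →
               L * b ≤ 3 * (g * n) × g * n ≤ 4 * (L * b)
ratio-bounds {L} {g} {n} {b} L≤g g≤4L n≤b b≤3n =
  ≤-trans (*-mono-≤ L≤g b≤3n) (≤-reflexive (regroup g n)) ,
  ≤-trans (*-mono-≤ g≤4L n≤b) (≤-reflexive (*-assoc 4 L b))
  where
  regroup : ∀ g n → g * (3 * n) ≡ 3 * (g * n)
  regroup = solve-∀

G∩Ball-restrict : ∀ {n N} → n ≤ N → ∀ u → G∩Ball n u ⇔ (G∩Ball N u × length u ≤ n)
G∩Ball-restrict n≤N u = mk⇔ (λ p@(_ , _ , le) → G∩Ball-mono n≤N u p , le) (λ ((gu , red , _) , le) → gu , red , le)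

count-between-powers : ∀ n j → 3 ^ suc j ≤ n → n < 3 ^ suc (suc j) →
  Σ ℕ λ g → CountIs (G∩Ball n) g × 2 ^ suc j ≤ g × g ≤ 4 * 2 ^ suc j
count-between-powers n j 3^k≤n n<3^k+1 =
  bounds (count-restrict (λ u → length u ≤? n) (G∩Ball-restrict n≤outer) (count-G∩Ball (suc (suc j))))
  where
  n≤outer : n ≤ 2 * 3 ^ suc (suc j)
  n≤outer = ≤-trans (<⇒≤ n<3^k+1) (m≤m+n _ _)
  inner≤n : 2 * 3 ^ j ≤ n
  inner≤n = ≤-trans (*-monoˡ-≤ (3 ^ j) (n≤1+n 2)) 3^k≤n
  double : ∀ x → x + x ≡ 2 * x
  double = solve-∀
  four-times : ∀ x → 2 * x + 2 * x ≡ 4 * x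
  four-times = solve-∀
  -- compare with the exact counts at radii 2·3^(k-1) ≤ n and 2·3^(k+1) ≥ n
  bounds : (Σ ℕ λ g → CountIs (G∩Ball n) g) → Σ ℕ λ g → CountIs (G∩Ball n) g × 2 ^ suc j ≤ g × g ≤ 4 * 2 ^ suc j
  bounds (g , count-g) = g , count-g ,
    subst (_≤ g) (double (2 ^ j)) (count-mono (G∩Ball-mono inner≤n) (count-G∩Ball j) count-g) ,
    subst (g ≤_) (four-times (2 ^ suc j)) (count-mono (G∩Ball-mono n≤outer) count-g (count-G∩Ball (suc (suc j))))

density-between-powers : (n k : ℕ) → 3 ≤ n → 3 ^ k ≤ n → n < 3 ^ suc k →
  Σ ℕ λ g → Σ ℕ λ b → CountIs (G∩Ball n) g × CountIs (Ball n) b ×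
    2 ^ k * b ≤ 3 * (g * n) × g * n ≤ 4 * (2 ^ k * b)
density-between-powers n zero 3≤n _ n<3 = ⊥-elim (<-irrefl refl (≤-<-trans 3≤n n<3))
density-between-powers n (suc j) 3≤n 3^k≤n n<3^k+1 with count-between-powers n j 3^k≤n n<3^k+1
... | g , count-g , lower , upper =
  g , suc (n + n) , count-g , count-ball n , ratio-bounds lower upper n≤b b≤3n
  where
  n≤b : n ≤ suc (n + n)
  n≤b = ≤-trans (m≤m+n n n) (n≤1+n _)
  b≤3n : suc (n + n) ≤ 3 * n
  b≤3n = ≤-trans (+-monoˡ-≤ (n + n) (≤-trans (s≤s z≤n) 3≤n)) (≤-reflexive (three-times n))
    where
    three-times : ∀ n → n + (n + n) ≡ 3 * n
    three-times = solve-∀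

-- the exact density at the radii 2·3^n, and the Θ((2/3)^(log₃ n)) density with
-- constants A = 3, B = 4 from radius N = 3 on (2^k / n ≈ (2/3)^k for n ≈ 3^k)
mainTheorem6 :
    ((n : ℕ) → Σ ℕ λ g → Σ ℕ λ b →
        CountIs (G∩Ball (2 * 3 ^ n)) g × CountIs (Ball (2 * 3 ^ n)) b ×
        g * (1 + 4 * 3 ^ n) ≡ 2 ^ (n + 1) * b)
    ×
    (Σ ℕ λ A → Σ ℕ λ B → Σ ℕ λ N → 1 ≤ A × 1 ≤ B ×
        ((n k : ℕ) → N ≤ n → 3 ^ k ≤ n → n < 3 ^ (suc k) →
          Σ ℕ λ g → Σ ℕ λ b →
            CountIs (G∩Ball n) g × CountIs (Ball n) b ×
            2 ^ k * b ≤ A * (g * n) × g * n ≤ B * (2 ^ k * b)))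
mainTheorem6 = density-at-powers , (3 , 4 , 3 , s≤s z≤n , s≤s z≤n , density-between-powers)
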